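{- Let $G$ be a graph with dual visibility spectrum $(1,r_1,\ldots,r_k)$. Then for every $i\in\{1,\ldots,\mu_{\rm t}(G)\}$ we have $r_i\ge \binom{\mu_{\rm t}(G)}{i}$. In particular $r_i>0$ for all $0\le i\le \mu_{\rm t}(G)$.
   Context: For a graph $G$ and $X\subseteq V(G)$, two vertices $x,y$ are $X$-visible if there is a shortest $x,y$-path in $G$ with no internal vertex in $X$. $X$ is a total mutual-visibility set if any two vertices of $V(G)$ are $X$-visible; a dual mutual-visibility set if any two vertices of $X$ and any two vertices of $V(G)\setminus X$ are $X$-visible. $\mu_{\rm t}(G)$ and $\mu_{\rm d}(G)$ are the maximum cardinalities of total, resp. dual, mutual-visibility sets. The dual visibility spectrum of $G$ is $(r_0,\ldots,r_k)$ with $k=\mu_{\rm d}(G)$ and $r_i$ the number of dual mutual-visibility sets of cardinality $i$. -}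

module Defs where

open import Data.Nat using (ℕ; zero; suc; _<_; _≤_)
open import Data.Fin using (Fin; zero; suc; toℕ; fromℕ; inject₁)
open import Data.Fin.Subset using (Subset; _∈_; _∉_; ∣_∣)
open import Data.Product using (Σ; ∃; ∃-syntax; _×_)
open import Data.List using (List; length)
open import Data.List.Membership.Propositional using () renaming (_∈_ to _∈ₗ_)
open import Data.List.Relation.Unary.Unique.Propositional using (Unique)
open import Relation.Nullary using (¬_)
open import Relation.Binary using (Decidable)
open import Relation.Binary.PropositionalEquality using (_≡_)

record Graph (n : ℕ) : Set₁ where
  field
    Adj    : Fin n → Fin n → Set
    adj?   : Decidable Adj
    sym    : ∀ {x y} → Adj x y → Adj y x
    irrefl : ∀ {x} → ¬ Adj x x

module _ {n : ℕ} (G : Graph n) where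
  open Graph G

  record Walk (x y : Fin n) (ℓ : ℕ) : Set where
    field
      vert  : Fin (suc ℓ) → Fin n
      start : vert zero ≡ x
      end   : vert (fromℕ ℓ) ≡ y
      step  : (i : Fin ℓ) → Adj (vert (inject₁ i)) (vert (suc i))
  open Walk public

  Connected : Set
  Connected = ∀ x y → ∃[ ℓ ] Walk x y ℓ

  -- A shortest x,y-path: a walk of length ℓ such that no x,y-walk is shorter.
  -- (A shortest walk is necessarily a path.)
  IsShortest : ∀ {x y ℓ} → Walk x y ℓ → Set
  IsShortest {x} {y} {ℓ} _ = ∀ ℓ' → ℓ' < ℓ → ¬ Walk x y ℓ'

  Visible : Subset n → Fin n → Fin n → Set
  Visible X x y =
    ∃[ ℓ ] Σ (Walk x y ℓ) λ w → IsShortest w ×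
      ((i : Fin (suc ℓ)) → 0 < toℕ i → toℕ i < ℓ → vert w i ∉ X)

  IsTotalMV : Subset n → Set
  IsTotalMV X = ∀ x y → Visible X x y

  IsDualMV : Subset n → Set
  IsDualMV X =
    (∀ x y → x ∈ X → y ∈ X → Visible X x y) ×
    (∀ x y → x ∉ X → y ∉ X → Visible X x y)

  IsMuT : ℕ → Set
  IsMuT m = (∃[ X ] IsTotalMV X × ∣ X ∣ ≡ m) × (∀ X → IsTotalMV X → ∣ X ∣ ≤ m)

  -- L is a duplicate-free enumeration of all dual mutual-visibility sets of
  -- cardinality i; hence length L = r_i (the i-th entry of the dual visibility spectrum).
  EnumDualOfSize : ℕ → List (Subset n) → Set
  EnumDualOfSize i L = Unique L × (∀ X → (X ∈ₗ L → IsDualMV X × ∣ X ∣ ≡ i)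
                                        × (IsDualMV X × ∣ X ∣ ≡ i → X ∈ₗ L))

-- Every subset of a total mutual-visibility set is again total, hence a dual
-- mutual-visibility set. A maximum total set has μ_t elements, so its subsets of
-- size i are C(μ_t, i) distinct dual mutual-visibility sets of size i.
module Submission where

open import Defs
open import Data.Nat using (ℕ; zero; suc; _+_; _≤_; _<_; _>_; z≤n; s≤s)
open import Data.Nat.Properties using (≤-trans; m≤m+n; +-comm; module ≤-Reasoning)
open import Data.Nat.Combinatorics using (_C_; nCk+nC[k+1]≡[n+1]C[k+1])
open import Data.Fin using (Fin; zero; suc)
open import Data.Fin.Properties using (injective⇒≤)
open import Data.Fin.Subset using (Subset; _⊆_; ∣_∣; inside; outside)
open import Data.Fin.Subset.Properties using (⊥⊆; out⊆; in⊆in)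
open import Data.Vec using ([]; _∷_)
open import Data.Vec.Properties using (∷-injectiveʳ)
open import Data.List using (List; []; _∷_; [_]; length; lookup; map; _++_)
open import Data.List.Properties using (length-map; length-++)
open import Data.List.Membership.Propositional using () renaming (_∈_ to _∈ₗ_)
open import Data.List.Membership.Propositional.Properties using (∈-lookup; ∈-map⁻; ∈-++⁻)
open import Data.List.Relation.Binary.Disjoint.Propositional using (Disjoint)
open import Data.List.Relation.Binary.Subset.Propositional using () renaming (_⊆_ to _⊆ₗ_)
open import Data.List.Relation.Unary.Any using (here; index)
open import Data.List.Relation.Unary.Any.Properties using (lookup-index)
import Data.List.Relation.Unary.All as All
open import Data.List.Relation.Unary.AllPairs using ([]; _∷_)
open import Data.List.Relation.Unary.Unique.Propositional using (Unique)
open import Data.List.Relation.Unary.Unique.Propositional.Properties using (map⁺; ++⁺)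
open import Data.Product using (_×_; _,_; proj₂)
open import Data.Sum using (inj₁; inj₂)
open import Function.Definitions using (Injective)
open import Relation.Nullary using (contradiction)
open import Relation.Binary.PropositionalEquality
  using (_≡_; refl; sym; trans; cong; cong₂; module ≡-Reasoning)

private
  variable
    A : Set
    n : ℕ

lookup-injective : {xs : List A} → Unique xs → Injective _≡_ _≡_ (lookup xs)
lookup-injective (_ ∷ _)        {zero}  {zero}  _  = refl
lookup-injective (x∉xs ∷ _)     {zero}  {suc j} eq = contradiction eq (All.lookup x∉xs (∈-lookup j))
lookup-injective (x∉xs ∷ _)     {suc i} {zero}  eq = contradiction (sym eq) (All.lookup x∉xs (∈-lookup i))
lookup-injective (_ ∷ xs-uniq)  {suc i} {suc j} eq = cong suc (lookup-injective xs-uniq eq)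

Unique-⊆⇒length≤ : {xs ys : List A} → Unique xs → xs ⊆ₗ ys → length xs ≤ length ys
Unique-⊆⇒length≤ {xs = xs} {ys} xs-uniq xs⊆ys = injective⇒≤ position-injective
  where
  position : Fin (length xs) → Fin (length ys)
  position k = index (xs⊆ys (∈-lookup k))

  position-injective : Injective _≡_ _≡_ position
  position-injective {k} {l} eq = lookup-injective xs-uniq (begin
    lookup xs k             ≡⟨ lookup-index (xs⊆ys (∈-lookup k)) ⟩
    lookup ys (position k)  ≡⟨ cong (lookup ys) eq ⟩
    lookup ys (position l)  ≡⟨ sym (lookup-index (xs⊆ys (∈-lookup l))) ⟩
    lookup xs l             ∎)
    where open ≡-Reasoning

k≤n⇒nCk>0 : ∀ {n k} → k ≤ n → n C k > 0
k≤n⇒nCk>0 {n}     {zero}  _         = s≤s z≤n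
k≤n⇒nCk>0 {suc n} {suc k} (s≤s k≤n) = begin-strict
  0                  <⟨ k≤n⇒nCk>0 k≤n ⟩
  n C k              ≤⟨ m≤m+n (n C k) (n C suc k) ⟩
  n C k + n C suc k  ≡⟨ nCk+nC[k+1]≡[n+1]C[k+1] n k ⟩
  suc n C suc k      ∎
  where open ≤-Reasoning

subsetsOfSize : Subset n → ℕ → List (Subset n)
subsetsOfSize []            zero    = [ [] ]
subsetsOfSize []            (suc i) = []
subsetsOfSize (outside ∷ X) i       = map (outside ∷_) (subsetsOfSize X i)
subsetsOfSize (inside ∷ X)  zero    = map (outside ∷_) (subsetsOfSize X zero)
subsetsOfSize (inside ∷ X)  (suc i) =
  map (outside ∷_) (subsetsOfSize X (suc i)) ++ map (inside ∷_) (subsetsOfSize X i)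

length-subsetsOfSize : (X : Subset n) (i : ℕ) → length (subsetsOfSize X i) ≡ ∣ X ∣ C i
length-subsetsOfSize []            zero    = refl
length-subsetsOfSize []            (suc i) = refl
length-subsetsOfSize (outside ∷ X) i       =
  trans (length-map _ (subsetsOfSize X i)) (length-subsetsOfSize X i)
length-subsetsOfSize (inside ∷ X)  zero    =
  trans (length-map _ (subsetsOfSize X zero)) (length-subsetsOfSize X zero)
length-subsetsOfSize (inside ∷ X)  (suc i) = begin
  length (map (outside ∷_) (subsetsOfSize X (suc i)) ++ map (inside ∷_) (subsetsOfSize X i))
    ≡⟨ length-++ (map (outside ∷_) (subsetsOfSize X (suc i))) ⟩
  length (map (outside ∷_) (subsetsOfSize X (suc i))) + length (map (inside ∷_) (subsetsOfSize X i))
    ≡⟨ cong₂ _+_ (length-map _ (subsetsOfSize X (suc i))) (length-map _ (subsetsOfSize X i)) ⟩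
  length (subsetsOfSize X (suc i)) + length (subsetsOfSize X i)
    ≡⟨ cong₂ _+_ (length-subsetsOfSize X (suc i)) (length-subsetsOfSize X i) ⟩
  ∣ X ∣ C suc i + ∣ X ∣ C i
    ≡⟨ +-comm (∣ X ∣ C suc i) (∣ X ∣ C i) ⟩
  ∣ X ∣ C i + ∣ X ∣ C suc i
    ≡⟨ nCk+nC[k+1]≡[n+1]C[k+1] ∣ X ∣ i ⟩
  suc ∣ X ∣ C suc i
    ∎
  where open ≡-Reasoning

Unique-subsetsOfSize : (X : Subset n) (i : ℕ) → Unique (subsetsOfSize X i)
Unique-subsetsOfSize []            zero    = All.[] ∷ []
Unique-subsetsOfSize []            (suc i) = []
Unique-subsetsOfSize (outside ∷ X) i       = map⁺ ∷-injectiveʳ (Unique-subsetsOfSize X i)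
Unique-subsetsOfSize (inside ∷ X)  zero    = map⁺ ∷-injectiveʳ (Unique-subsetsOfSize X zero)
Unique-subsetsOfSize (inside ∷ X)  (suc i) =
  ++⁺ (map⁺ ∷-injectiveʳ (Unique-subsetsOfSize X (suc i)))
      (map⁺ ∷-injectiveʳ (Unique-subsetsOfSize X i))
      heads-differ
  where
  heads-differ : Disjoint (map (outside ∷_) (subsetsOfSize X (suc i)))
                          (map (inside ∷_) (subsetsOfSize X i))
  heads-differ (Y∈ˡ , Y∈ʳ) with ∈-map⁻ (outside ∷_) Y∈ˡ | ∈-map⁻ (inside ∷_) Y∈ʳ
  ... | _ , _ , refl | _ , _ , ()

∈-map-outside : ∀ {b} (X : Subset n) (i : ℕ) {Y : Subset (suc n)} →
                Y ∈ₗ map (outside ∷_) (subsetsOfSize X i) → Y ⊆ b ∷ X × ∣ Y ∣ ≡ i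

∈-subsetsOfSize⁻ : (X : Subset n) (i : ℕ) {Y : Subset n} →
                   Y ∈ₗ subsetsOfSize X i → Y ⊆ X × ∣ Y ∣ ≡ i
∈-subsetsOfSize⁻ []            zero    (here refl) = ⊥⊆ , refl
∈-subsetsOfSize⁻ (outside ∷ X) i       Y∈ = ∈-map-outside X i Y∈
∈-subsetsOfSize⁻ (inside ∷ X)  zero    Y∈ = ∈-map-outside X zero Y∈
∈-subsetsOfSize⁻ (inside ∷ X)  (suc i) Y∈
  with ∈-++⁻ (map (outside ∷_) (subsetsOfSize X (suc i))) Y∈
... | inj₁ Y∈ˡ = ∈-map-outside X (suc i) Y∈ˡ
... | inj₂ Y∈ʳ with ∈-map⁻ (inside ∷_) Y∈ʳ
...   | Z , Z∈ , refl with ∈-subsetsOfSize⁻ X i Z∈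
...     | Z⊆X , ∣Z∣≡i = in⊆in Z⊆X , cong suc ∣Z∣≡i

∈-map-outside X i Y∈ with ∈-map⁻ (outside ∷_) Y∈
... | Z , Z∈ , refl with ∈-subsetsOfSize⁻ X i Z∈
...   | Z⊆X , ∣Z∣≡i = out⊆ Z⊆X , ∣Z∣≡i

module _ (G : Graph n) where

  IsTotalMV-⊆ : {X Y : Subset n} → Y ⊆ X → IsTotalMV G X → IsTotalMV G Y
  IsTotalMV-⊆ Y⊆X X-total x y with X-total x y
  ... | ℓ , w , w-shortest , inner∉X =
    ℓ , w , w-shortest , λ k 0<k k<ℓ w[k]∈Y → inner∉X k 0<k k<ℓ (Y⊆X w[k]∈Y)

  IsTotalMV⇒IsDualMV : {X : Subset n} → IsTotalMV G X → IsDualMV G X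
  IsTotalMV⇒IsDualMV X-total = (λ x y _ _ → X-total x y) , (λ x y _ _ → X-total x y)

  IsTotalMV⇒C≤length : {X : Subset n} {i : ℕ} {L : List (Subset n)} →
                       IsTotalMV G X → EnumDualOfSize G i L → ∣ X ∣ C i ≤ length L
  IsTotalMV⇒C≤length {X} {i} {L} X-total (_ , L-enumerates) = begin
    ∣ X ∣ C i                  ≡⟨ length-subsetsOfSize X i ⟨
    length (subsetsOfSize X i) ≤⟨ Unique-⊆⇒length≤ (Unique-subsetsOfSize X i) subsets⊆L ⟩
    length L                   ∎
    where
    open ≤-Reasoning
    subsets⊆L : subsetsOfSize X i ⊆ₗ L
    subsets⊆L {Y} Y∈ with ∈-subsetsOfSize⁻ X i Y∈
    ... | Y⊆X , ∣Y∣≡i =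
      proj₂ (L-enumerates Y) (IsTotalMV⇒IsDualMV (IsTotalMV-⊆ Y⊆X X-total) , ∣Y∣≡i)

mainTheorem11 : ∀ {n} (G : Graph n) → Connected G → (m : ℕ) → IsMuT G m →
    (i : ℕ) → (L : List (Subset n)) → EnumDualOfSize G i L →
    (1 ≤ i → i ≤ m → m C i ≤ length L) × (i ≤ m → 0 < length L)
mainTheorem11 G _ m ((X , X-total , refl) , _) i L L-enum =
  (λ _ _ → mC≤length) , (λ i≤m → ≤-trans (k≤n⇒nCk>0 i≤m) mC≤length)
  where
  mC≤length : m C i ≤ length L
  mC≤length = IsTotalMV⇒C≤length G X-total L-enum
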